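{- Let $A,B$ be Boolean matrices of dimensions $a\times b$ and $b\times c$, and let $S_A$, $S_B$ be the strings defined in the context. Let $i\in[0\mathinner{.\,.} a)$, $j\in[0\mathinner{.\,.} c)$ and $x\in[1\mathinner{.\,.}\min(a-i,c-j)]$. Then $\mathrm{LCEW}_{S_A,S_B}(bi+1,bj+1)\ge bx$ if and only if $(AB)[i+y,j+y]=0$ for every $y\in[1\mathinner{.\,.} x]$.
   Context: $AB$ is the Boolean matrix product. $\lozenge$ is a wildcard: $u\sim v$ iff $u=v$ or $u=\lozenge$ or $v=\lozenge$, extended positionwise to equal-length strings. Define $\phi_A(1)=1$, $\phi_A(0)=\lozenge$, $\phi_B(1)=0$, $\phi_B(0)=1$. $S_A$ is the string of length $ab$ with $S_A[b\cdot i+j+1]=\phi_A(A[i+1,j+1])$ for $i\in[0\mathinner{.\,.} a)$, $j\in[0\mathinner{.\,.} b)$ (row-major encoding), and $S_B$ is the string of length $bc$ with $S_B[i+b\cdot j+1]=\phi_B(B[i+1,j+1])$ for $i\in[0\mathinner{.\,.} b)$, $j\in[0\mathinner{.\,.} c)$ (column-major encoding). For strings $P,Q$, $P[i\mathinner{.\,.} i+\ell)=P[i]\cdots P[i+\ell-1]$ and $\mathrm{LCEW}_{P,Q}(i,j)=\max\{\ell\le\min(|P|-i,|Q|-j)+1 : P[i\mathinner{.\,.} i+\ell)\sim Q[j\mathinner{.\,.} j+\ell)\}$. -}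

module Defs where

open import Data.Bool using (Bool; true; false; _∧_; if_then_else_)
open import Data.Nat using (ℕ; zero; suc; _+_; _*_; _∸_; _⊓_)
open import Data.Fin using (Fin; remQuot)
open import Data.Product using (_,_)
open import Data.Maybe using (Maybe; just; nothing)
open import Data.List using (List; []; _∷_; length; allFin; upTo)
open import Data.Bool.ListAction using (all; any)
open import Data.Vec.Functional using (Vector)

-- Boolean matrices, 0-based indices (entry M[r+1,s+1] of the paper is M r s)
BMat : ℕ → ℕ → Set
BMat m n = Fin m → Fin n → Bool

_⊗_ : ∀ {a b c} → BMat a b → BMat b c → BMat a c
_⊗_ {b = b} A B r s = any (λ k → A r k ∧ B k s) (allFin b)

data Sym : Set where
  𝟘 𝟙 ◇ : Sym

_∼_ : Sym → Sym → Bool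
◇ ∼ _ = true
_ ∼ ◇ = true
𝟘 ∼ 𝟘 = true
𝟙 ∼ 𝟙 = true
𝟘 ∼ 𝟙 = false
𝟙 ∼ 𝟘 = false

φA : Bool → Sym
φA true  = 𝟙
φA false = ◇

φB : Bool → Sym
φB true  = 𝟘
φB false = 𝟙

Str : Set
Str = List Sym

toStr : ∀ {n} → Vector Sym n → Str
toStr {n} v = Data.List.map v (allFin n)

-- S_A : row-major, position b·i+j (0-based) holds φA(A[i+1,j+1])
SA : ∀ {a b} → BMat a b → Str
SA {a} {b} A = toStr {a * b} (λ p → let (i , j) = remQuot {a} b p in φA (A i j))

-- S_B : column-major, position i+b·j (0-based) holds φB(B[i+1,j+1])
SB : ∀ {b c} → BMat b c → Str
SB {b} {c} B = toStr {c * b} (λ p → let (j , i) = remQuot {c} b p in φB (B i j))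

-- 1-based character access P[k]; nothing when out of range
at : Str → ℕ → Maybe Sym
at _ zero = nothing
at [] (suc _) = nothing
at (x ∷ _) (suc zero) = just x
at (_ ∷ xs) (suc (suc k)) = at xs (suc k)

simM : Maybe Sym → Maybe Sym → Bool
simM (just u) (just v) = u ∼ v
simM _ _ = false

matches : Str → ℕ → Str → ℕ → ℕ → Bool
matches P i Q j ℓ = all (λ k → simM (at P (i + k)) (at Q (j + k))) (upTo ℓ)

maxSat : ℕ → (ℕ → Bool) → ℕ
maxSat zero f = zero
maxSat (suc n) f = if f (suc n) then suc n else maxSat n f

LCEW : Str → Str → ℕ → ℕ → ℕ
LCEW P Q i j = maxSat (((length P ∸ i) ⊓ (length Q ∸ j)) + 1) (matches P i Q j)

{-# OPTIONS --safe #-}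
module Submission where

-- Offset b·q + m (m < b) of the two windows compares A[i+q, m], read row-major from S_A, with
-- B[m, j+q], read column-major from S_B; under φA, φB the two symbols mismatch exactly when both
-- entries are 1. So the first b·x characters of the windows match iff no witness m exists for
-- any of the entries (AB)[i+q, j+q], q < x. The window bound x ≤ min(a - i, c - j) makes b·x
-- fall within the range over which LCEW maximises, so b·x ≤ LCEW says exactly that.

open import Defs
open import Data.Bool using (Bool; true; false; not; _∧_; T)
open import Data.Bool.ListAction using (all; any)
open import Data.Bool.Properties using (T-≡)
open import Data.Fin using (Fin; zero; suc; toℕ; fromℕ<; combine; remQuot)
open import Data.Fin.Properties using (toℕ<n; toℕ-fromℕ<; toℕ-combine; remQuot-combine; combine-remQuot)
open import Data.List using (length; tabulate; upTo)
open import Data.List.Properties using (length-map; length-tabulate; map-tabulate)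
open import Data.List.Relation.Unary.All.Properties using (all⁺; all⁻; applyUpTo⁺₁; applyUpTo⁻)
open import Data.Maybe using (just)
open import Data.Nat using (ℕ; zero; suc; _+_; _*_; _∸_; _⊓_; _≤_; _<_; z≤n; z<s; s≤s⁻¹)
open import Data.Nat.Properties
open import Data.Nat.Tactic.RingSolver using (solve-∀)
open import Data.Product using (proj₁; proj₂; uncurry)
open import Data.Sum using (_⊎_; inj₁; inj₂)
open import Data.Vec.Functional using (Vector)
open import Function using (id; _∘_; flip)
open import Function.Bundles using (_⇔_; mk⇔; Equivalence)
open import Function.Related.Propositional using (module EquationalReasoning; equivalence)
open import Relation.Binary.PropositionalEquality
open import Relation.Nullary using (contradiction)

open Equivalence using (to; from)

all-upTo≡true⇔ : (p : ℕ → Bool) (n : ℕ) →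
                 all p (upTo n) ≡ true ⇔ (∀ {k} → k < n → p k ≡ true)
all-upTo≡true⇔ p n = mk⇔ elementwise (to T-≡ ∘ all⁻ p ∘ applyUpTo⁺₁ id n ∘ elementwise-T)
  where
  elementwise : all p (upTo n) ≡ true → ∀ {k} → k < n → p k ≡ true
  elementwise h k<n = to T-≡ (applyUpTo⁻ id n (all⁺ p (upTo n) (from T-≡ h)) k<n)
  elementwise-T : (∀ {k} → k < n → p k ≡ true) → ∀ {k} → k < n → T (p k)
  elementwise-T h k<n = from T-≡ (h k<n)

any-tabulate≡false⇔ : ∀ {A : Set} {n} (p : A → Bool) (f : Fin n → A) →
                      any p (tabulate f) ≡ false ⇔ (∀ m → p (f m) ≡ false)
any-tabulate≡false⇔ {n = zero} p f = mk⇔ (λ _ ()) (λ _ → refl)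
any-tabulate≡false⇔ {n = suc n} p f with p (f zero) in e | any-tabulate≡false⇔ p (f ∘ suc)
... | true  | _  = mk⇔ (λ ()) (λ h → trans (sym e) (h zero))
... | false | ih = mk⇔ (λ h → λ { zero → e ; (suc m) → to ih h m }) (λ h → from ih (h ∘ suc))

maxSat≡0⊎sat : ∀ n f → maxSat n f ≡ 0 ⊎ f (maxSat n f) ≡ true
maxSat≡0⊎sat zero    f = inj₁ refl
maxSat≡0⊎sat (suc n) f with f (suc n) in e
... | true  = inj₂ e
... | false = maxSat≡0⊎sat n f

≤-maxSat : ∀ n f {m} → m ≤ n → f m ≡ true → m ≤ maxSat n f
≤-maxSat zero    f z≤n _ = z≤n
≤-maxSat (suc n) f {m} m≤1+n fm with f (suc n) in e
... | true  = m≤1+n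
... | false with m≤n⇒m<n∨m≡n m≤1+n
...   | inj₁ m<1+n = ≤-maxSat n f (s≤s⁻¹ m<1+n) fm
...   | inj₂ refl  = contradiction (trans (sym fm) e) λ ()

≤-maxSat-all-upTo⇔ : ∀ n (p : ℕ → Bool) {m} → m ≤ n →
                     m ≤ maxSat n (λ ℓ → all p (upTo ℓ)) ⇔ (∀ {k} → k < m → p k ≡ true)
≤-maxSat-all-upTo⇔ n p {m} m≤n = mk⇔ prefix (≤-maxSat n f m≤n ∘ from (all-upTo≡true⇔ p m))
  where
  f : ℕ → Bool
  f ℓ = all p (upTo ℓ)
  prefix : m ≤ maxSat n f → ∀ {k} → k < m → p k ≡ true
  prefix m≤max k<m with k<max ← <-≤-trans k<m m≤max | maxSat≡0⊎sat n f
  ... | inj₁ max≡0 = contradiction (subst (_ <_) max≡0 k<max) n≮0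
  ... | inj₂ sat   = to (all-upTo≡true⇔ p _) sat k<max

<-*-blocks⇔ : (P : ℕ → Set) (b x : ℕ) →
              (∀ {k} → k < b * x → P k) ⇔ (∀ {q} → q < x → (m : Fin b) → P (b * q + toℕ m))
<-*-blocks⇔ P b x = mk⇔ restrict split
  where
  block-< : ∀ {q} → q < x → (m : Fin b) → b * q + toℕ m < b * x
  block-< {q} q<x m = begin-strict
    b * q + toℕ m  <⟨ +-monoʳ-< (b * q) (toℕ<n m) ⟩
    b * q + b      ≡⟨ +-comm (b * q) b ⟩
    b + b * q      ≡⟨ *-suc b q ⟨
    b * suc q      ≤⟨ *-monoʳ-≤ b q<x ⟩
    b * x          ∎
    where open ≤-Reasoning
  restrict : (∀ {k} → k < b * x → P k) → ∀ {q} → q < x → (m : Fin b) → P (b * q + toℕ m)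
  restrict h q<x m = h (block-< q<x m)
  split : (∀ {q} → q < x → (m : Fin b) → P (b * q + toℕ m)) → ∀ {k} → k < b * x → P k
  split h {k} k<bx = subst P k≡bq+m (h (toℕ<n q) m)
    where
    k′ : Fin (x * b)
    k′ = fromℕ< (subst (k <_) (*-comm b x) k<bx)
    q : Fin x
    q = proj₁ (remQuot {x} b k′)
    m : Fin b
    m = proj₂ (remQuot {x} b k′)
    k≡bq+m : b * toℕ q + toℕ m ≡ k
    k≡bq+m = begin
      b * toℕ q + toℕ m  ≡⟨ toℕ-combine q m ⟨
      toℕ (combine q m)  ≡⟨ cong toℕ (combine-remQuot {x} b k′) ⟩
      toℕ k′             ≡⟨ toℕ-fromℕ< _ ⟩
      k                  ∎
      where open ≡-Reasoning

at-tabulate : ∀ {n} (f : Fin n → Sym) (p : Fin n) → at (tabulate f) (suc (toℕ p)) ≡ just (f p)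
at-tabulate f zero    = refl
at-tabulate f (suc p) = at-tabulate (f ∘ suc) p

at-toStr : ∀ {n} (v : Vector Sym n) (p : Fin n) → at (toStr v) (suc (toℕ p)) ≡ just (v p)
at-toStr v p = trans (cong (λ s → at s (suc (toℕ p))) (map-tabulate id v)) (at-tabulate v p)

length-toStr : ∀ {n} (v : Vector Sym n) → length (toStr v) ≡ n
length-toStr {n} v = trans (length-map v (tabulate {n = n} id)) (length-tabulate id)

at-SA : ∀ {a b} (A : BMat a b) (r : Fin a) (m : Fin b) →
        at (SA A) (suc (b * toℕ r + toℕ m)) ≡ just (φA (A r m))
at-SA {b = b} A r m = begin
  at (SA A) (suc (b * toℕ r + toℕ m))
    ≡⟨ cong (at (SA A) ∘ suc) (toℕ-combine r m) ⟨
  at (SA A) (suc (toℕ (combine r m)))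
    ≡⟨ at-toStr _ (combine r m) ⟩
  just (φA (uncurry A (remQuot b (combine r m))))
    ≡⟨ cong (just ∘ φA ∘ uncurry A) (remQuot-combine r m) ⟩
  just (φA (A r m))
    ∎
  where open ≡-Reasoning

at-SB : ∀ {b c} (B : BMat b c) (s : Fin c) (m : Fin b) →
        at (SB B) (suc (b * toℕ s + toℕ m)) ≡ just (φB (B m s))
at-SB {b} B s m = begin
  at (SB B) (suc (b * toℕ s + toℕ m))
    ≡⟨ cong (at (SB B) ∘ suc) (toℕ-combine s m) ⟨
  at (SB B) (suc (toℕ (combine s m)))
    ≡⟨ at-toStr _ (combine s m) ⟩
  just (φB (uncurry (flip B) (remQuot b (combine s m))))
    ≡⟨ cong (just ∘ φB ∘ uncurry (flip B)) (remQuot-combine s m) ⟩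
  just (φB (B m s))
    ∎
  where open ≡-Reasoning

φA∼φB≡nand : ∀ u v → (φA u ∼ φB v) ≡ not (u ∧ v)
φA∼φB≡nand true  true  = refl
φA∼φB≡nand true  false = refl
φA∼φB≡nand false true  = refl
φA∼φB≡nand false false = refl

not≡true⇔≡false : ∀ {x} → not x ≡ true ⇔ x ≡ false
not≡true⇔≡false {false} = mk⇔ (λ _ → refl) (λ _ → refl)
not≡true⇔≡false {true}  = mk⇔ (λ ()) (λ ())

m∸n≤m∸[n+1]+1 : ∀ m n → m ∸ n ≤ m ∸ (n + 1) + 1
m∸n≤m∸[n+1]+1 m n = begin
  m ∸ n            ≤⟨ m≤n+m∸n (m ∸ n) 1 ⟩
  1 + (m ∸ n ∸ 1)  ≡⟨ +-comm 1 (m ∸ n ∸ 1) ⟩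
  m ∸ n ∸ 1 + 1    ≡⟨ cong (_+ 1) (∸-+-assoc m n 1) ⟩
  m ∸ (n + 1) + 1  ∎
  where open ≤-Reasoning

block-window-fits : ∀ a b t {x} → x ≤ a ∸ t → b * x ≤ a * b ∸ (b * t + 1) + 1
block-window-fits a b t {x} x≤a∸t = begin
  b * x                    ≤⟨ *-monoʳ-≤ b x≤a∸t ⟩
  b * (a ∸ t)              ≡⟨ *-distribˡ-∸ b a t ⟩
  b * a ∸ b * t            ≡⟨ cong (_∸ b * t) (*-comm b a) ⟩
  a * b ∸ b * t            ≤⟨ m∸n≤m∸[n+1]+1 (a * b) (b * t) ⟩
  a * b ∸ (b * t + 1) + 1  ∎
  where open ≤-Reasoning

window-offset : ∀ b t q m → b * t + 1 + (b * q + m) ≡ suc (b * (t + q) + m)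
window-offset = solve-∀

module _ {a b c} (A : BMat a b) (B : BMat b c) (i : Fin a) (j : Fin c) where

  agree : ℕ → Bool
  agree k = simM (at (SA A) (b * toℕ i + 1 + k)) (at (SB B) (b * toℕ j + 1 + k))

  ≤-LCEW⇔agree : ∀ {x} → x ≤ a ∸ toℕ i → x ≤ c ∸ toℕ j →
                 b * x ≤ LCEW (SA A) (SB B) (b * toℕ i + 1) (b * toℕ j + 1)
                 ⇔ (∀ {k} → k < b * x → agree k ≡ true)
  ≤-LCEW⇔agree {x} x≤a∸i x≤c∸j = ≤-maxSat-all-upTo⇔ _ agree fits
    where
    open ≤-Reasoning
    fits : b * x ≤ (length (SA A) ∸ (b * toℕ i + 1)) ⊓ (length (SB B) ∸ (b * toℕ j + 1)) + 1
    fits = begin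
      b * x
        ≤⟨ ⊓-glb (block-window-fits a b (toℕ i) x≤a∸i) (block-window-fits c b (toℕ j) x≤c∸j) ⟩
      (a * b ∸ (b * toℕ i + 1) + 1) ⊓ (c * b ∸ (b * toℕ j + 1) + 1)
        ≡⟨ +-distribʳ-⊓ 1 (a * b ∸ (b * toℕ i + 1)) (c * b ∸ (b * toℕ j + 1)) ⟨
      (a * b ∸ (b * toℕ i + 1)) ⊓ (c * b ∸ (b * toℕ j + 1)) + 1
        ≡⟨ cong₂ (λ m n → (m ∸ (b * toℕ i + 1)) ⊓ (n ∸ (b * toℕ j + 1)) + 1)
                 (length-toStr _) (length-toStr _) ⟨
      (length (SA A) ∸ (b * toℕ i + 1)) ⊓ (length (SB B) ∸ (b * toℕ j + 1)) + 1
        ∎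

  agree-block : ∀ {q r s} → toℕ r ≡ toℕ i + q → toℕ s ≡ toℕ j + q →
                (m : Fin b) → agree (b * q + toℕ m) ≡ not (A r m ∧ B m s)
  agree-block {q} {r} {s} r≡i+q s≡j+q m = begin
    agree (b * q + toℕ m)
      ≡⟨ cong₂ simM (cong (at (SA A)) (offset r≡i+q)) (cong (at (SB B)) (offset s≡j+q)) ⟩
    simM (at (SA A) (suc (b * toℕ r + toℕ m))) (at (SB B) (suc (b * toℕ s + toℕ m)))
      ≡⟨ cong₂ simM (at-SA A r m) (at-SB B s m) ⟩
    (φA (A r m) ∼ φB (B m s))
      ≡⟨ φA∼φB≡nand (A r m) (B m s) ⟩
    not (A r m ∧ B m s)
      ∎
    where
    open ≡-Reasoning
    offset : ∀ {t n} {u : Fin n} → toℕ u ≡ t + q →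
             b * t + 1 + (b * q + toℕ m) ≡ suc (b * toℕ u + toℕ m)
    offset {t} u≡t+q =
      trans (window-offset b t q (toℕ m)) (cong (λ v → suc (b * v + toℕ m)) (sym u≡t+q))

  block-agrees⇔⊗≡false : ∀ {q r s} → toℕ r ≡ toℕ i + q → toℕ s ≡ toℕ j + q →
                         (∀ m → agree (b * q + toℕ m) ≡ true) ⇔ (A ⊗ B) r s ≡ false
  block-agrees⇔⊗≡false {q} {r} {s} r≡i+q s≡j+q = mk⇔ product-zero block-agrees
    where
    no-witness : (A ⊗ B) r s ≡ false ⇔ (∀ m → (A r m ∧ B m s) ≡ false)
    no-witness = any-tabulate≡false⇔ (λ m → A r m ∧ B m s) id
    product-zero : (∀ m → agree (b * q + toℕ m) ≡ true) → (A ⊗ B) r s ≡ false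
    product-zero h = from no-witness λ m →
      to not≡true⇔≡false (trans (sym (agree-block r≡i+q s≡j+q m)) (h m))
    block-agrees : (A ⊗ B) r s ≡ false → ∀ m → agree (b * q + toℕ m) ≡ true
    block-agrees h m =
      trans (agree-block r≡i+q s≡j+q m) (from not≡true⇔≡false (to no-witness h m))

  BlocksAgree : ℕ → Set
  BlocksAgree x = ∀ {q} → q < x → (m : Fin b) → agree (b * q + toℕ m) ≡ true

  DiagonalVanishes : ℕ → Set
  DiagonalVanishes x = ∀ (y : ℕ) (r : Fin a) (s : Fin c) → 1 ≤ y → y ≤ x →
                       suc (toℕ r) ≡ toℕ i + y → suc (toℕ s) ≡ toℕ j + y → (A ⊗ B) r s ≡ false

  blocks⇔diagonal : ∀ {x} → x ≤ a ∸ toℕ i → x ≤ c ∸ toℕ j → BlocksAgree x ⇔ DiagonalVanishes x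
  blocks⇔diagonal {x} x≤a∸i x≤c∸j = mk⇔ diagonal blocks
    where
    shift : ∀ {m n q} → suc m ≡ n + suc q ⇔ m ≡ n + q
    shift {m} {n} {q} = mk⇔ (λ e → suc-injective (trans e (+-suc n q)))
                            (λ e → trans (cong suc e) (sym (+-suc n q)))
    diagonal : BlocksAgree x → DiagonalVanishes x
    diagonal h (suc q) r s _ q<x r≡i+y s≡j+y =
      to (block-agrees⇔⊗≡false (to shift r≡i+y) (to shift s≡j+y)) (h q<x)
    blocks : DiagonalVanishes x → BlocksAgree x
    blocks h {q} q<x = from (block-agrees⇔⊗≡false r≡i+q s≡j+q)
                            (h (suc q) r s z<s q<x (from shift r≡i+q) (from shift s≡j+q))
      where
      r : Fin a
      r = fromℕ< (m≤o∸n⇒m+n≤o (suc q) (<⇒≤ (toℕ<n i)) (<-≤-trans q<x x≤a∸i))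
      s : Fin c
      s = fromℕ< (m≤o∸n⇒m+n≤o (suc q) (<⇒≤ (toℕ<n j)) (<-≤-trans q<x x≤c∸j))
      r≡i+q : toℕ r ≡ toℕ i + q
      r≡i+q = trans (toℕ-fromℕ< _) (+-comm q (toℕ i))
      s≡j+q : toℕ s ≡ toℕ j + q
      s≡j+q = trans (toℕ-fromℕ< _) (+-comm q (toℕ j))

lemma7 : (a b c : ℕ) (A : BMat a b) (B : BMat b c) (i : Fin a) (j : Fin c) (x : ℕ) →
         1 ≤ x → x ≤ a ∸ toℕ i → x ≤ c ∸ toℕ j →
         (b * x ≤ LCEW (SA A) (SB B) (b * toℕ i + 1) (b * toℕ j + 1))
           ⇔ (∀ (y : ℕ) (r : Fin a) (s : Fin c) → 1 ≤ y → y ≤ x →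
                suc (toℕ r) ≡ toℕ i + y → suc (toℕ s) ≡ toℕ j + y →
                (A ⊗ B) r s ≡ false)
lemma7 a b c A B i j x _ x≤a∸i x≤c∸j = begin
  (b * x ≤ LCEW (SA A) (SB B) (b * toℕ i + 1) (b * toℕ j + 1))
    ∼⟨ ≤-LCEW⇔agree A B i j x≤a∸i x≤c∸j ⟩
  (∀ {k} → k < b * x → agree A B i j k ≡ true)
    ∼⟨ <-*-blocks⇔ (λ k → agree A B i j k ≡ true) b x ⟩
  BlocksAgree A B i j x
    ∼⟨ blocks⇔diagonal A B i j x≤a∸i x≤c∸j ⟩
  DiagonalVanishes A B i j x
    ∎
  where open EquationalReasoning {k = equivalence}
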